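{- Let $G$ and $H$ be circuits with leaves labeled by literals over $\mathbf{I}$ and $\mathbf{X}$ (with disjoint node sets). If $G$ is in SAUNF with respect to $\mathrm{set}(\mathbf{X})$ and a sequence $S^G$, and $H$ is in SAUNF with respect to $\mathrm{set}(\mathbf{X})$ and a sequence $S^H$, then the circuit $G\vee H$ is in SAUNF with respect to $\mathrm{set}(\mathbf{X})$ and the concatenated sequence $(S^G,S^H)$.
   Context: Boolean values are $\bot,\top$. $\mathbf{I}$ (system inputs) and $\mathbf{X}$ (system outputs) are disjoint sequences of Boolean variables; $\mathrm{set}(\mathbf{V})$ is the set of variables of $\mathbf{V}$. A circuit is an NNF circuit: a rooted DAG whose nodes are all descendants of the root, internal nodes labeled $\wedge$ or $\vee$ with two children, leaves labeled by literals or constants $\top,\bot$ (labels may repeat). $\varphi_G$ is the represented formula, $[\![\varphi_G]\!]$ its Boolean function. $G\vee H$ (resp. $G\wedge H$) is the circuit whose root is a $\vee$- (resp. $\wedge$-) node with the roots of $G$ and $H$ as children. An $\ell$-leaf is a leaf labeled $\ell$; a set of leaves is literal-consistent if all carry the same literal. $G|_{L:b}$ relabels each leaf in $L$ by $b$; $G|_{\ell_1=b_1,\dots}$ relabels all $\ell_j$-leaves by $b_j$ ($\ell$, $\neg\ell$ distinct). $[\![\varphi]\!]_\sigma$ denotes substitution of an assignment $\sigma$. For a literal $\ell$ labeling a leaf of $G$ with variable $v_\ell$ and fresh $w,w'$: $\ell$ is $\wedge$-realizable in $G$ iff some assignment $\sigma$ of $(\mathrm{set}(\mathbf{I})\cup\mathrm{set}(\mathbf{X}))\setminus\{v_\ell\}$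 gives $[\![G|_{\ell=w,\neg\ell=w'}]\!]_\sigma=[\![w\wedge w']\!]$, else $\wedge$-unrealizable. A literal-consistent set $S$ of $\ell$-leaves, with $S'$ all $\ell$-leaves, is $\wedge$-(un)realizable in $G$ iff $\ell$ is $\wedge$-(un)realizable in $G|_{S'\setminus S:\bot}$. $G$ is in SAUNF w.r.t. $\mathrm{set}(\mathbf{X})$ and a non-empty sequence $S=(S_1,\dots,S_k)$ of leaf sets iff: the $S_j$ are pairwise disjoint; each $S_j$ is literal-consistent with a literal over $\mathbf{X}$; $S_1$ is $\wedge$-unrealizable in $G$; for $2\le j\le k$, $S_j$ is $\wedge$-unrealizable in $G|_{S_1:\top,\dots,S_{j-1}:\top}$; and $[\![\varphi_{G|_{S_1:\top,\dots,S_k:\top}}]\!]$ does not depend on $\mathbf{X}$. -}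

module Defs where

open import Data.Bool using (Bool; true; false; _∧_; _∨_; not; if_then_else_)
open import Data.Bool.Properties using () renaming (_≟_ to _≟ᵇ_)
open import Data.Fin using (Fin)
open import Data.Fin.Properties using () renaming (_≟_ to _≟ᶠ_)
open import Data.Sum using (_⊎_; inj₁; inj₂)
open import Data.Sum.Properties using (≡-dec)
open import Data.Product using (Σ; ∃; _×_; _,_)
open import Data.List using (List; []; _∷_; map; _++_; length)
open import Data.List.Relation.Unary.All using (All)
open import Data.Nat using (ℕ; _<_)
open import Relation.Nullary using (¬_; does)
open import Relation.Binary.PropositionalEquality using (_≡_; _≢_)

-- Variables: inputs I (Fin ni) and outputs X (Fin nx), disjoint.

Var : ℕ → ℕ → Set
Var ni nx = Fin ni ⊎ Fin nx

_≟v_ : ∀ {ni nx} (u v : Var ni nx) → _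
_≟v_ = ≡-dec _≟ᶠ_ _≟ᶠ_

-- A literal: a variable with a polarity (true = positive, false = negated).
record Lit (ni nx : ℕ) : Set where
  constructor mkLit
  field
    var : Var ni nx
    pol : Bool
open Lit public

IsXLit : ∀ {ni nx} → Lit ni nx → Set
IsXLit ℓ = Σ _ λ x → var ℓ ≡ inj₂ x

data Label (ni nx : ℕ) : Set where
  lit : Lit ni nx → Label ni nx
  cst : Bool → Label ni nx

isLit : ∀ {ni nx} → Lit ni nx → Label ni nx → Bool
isLit ℓ (lit ℓ') = does (var ℓ' ≟v var ℓ) ∧ does (pol ℓ' ≟ᵇ pol ℓ)
isLit ℓ (cst _)  = false

-- The leaf NODES of a circuit are identified by elements of
-- a type L (equal identifiers = the same shared leaf node). The DAG is
-- given by its unfolding (sharing of internal nodes does not affect the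
-- represented formula nor any leaf set); each leaf node carries a label.

data Tree (L : Set) : Set where
  leaf : L → Tree L
  and  : Tree L → Tree L → Tree L
  or   : Tree L → Tree L → Tree L

record Circuit (ni nx : ℕ) (L : Set) : Set where
  constructor mkCircuit
  field
    tree : Tree L
    lab  : L → Label ni nx
open Circuit public

data Occurs {L : Set} (l : L) : Tree L → Set where
  here  : Occurs l (leaf l)
  andˡ  : ∀ {t u} → Occurs l t → Occurs l (and t u)
  andʳ  : ∀ {t u} → Occurs l u → Occurs l (and t u)
  orˡ   : ∀ {t u} → Occurs l t → Occurs l (or t u)
  orʳ   : ∀ {t u} → Occurs l u → Occurs l (or t u)

mapTree : ∀ {A B : Set} → (A → B) → Tree A → Tree B
mapTree f (leaf a)  = leaf (f a)
mapTree f (and t u) = and (mapTree f t) (mapTree f u)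
mapTree f (or t u)  = or (mapTree f t) (mapTree f u)

[_,_]ˡ : ∀ {A B C : Set} → (A → C) → (B → C) → A ⊎ B → C
[ f , g ]ˡ (inj₁ a) = f a
[ f , g ]ˡ (inj₂ b) = g b

_∨ᶜ_ : ∀ {ni nx L M} → Circuit ni nx L → Circuit ni nx M → Circuit ni nx (L ⊎ M)
G ∨ᶜ H = mkCircuit (or (mapTree inj₁ (tree G)) (mapTree inj₂ (tree H)))
                   [ lab G , lab H ]ˡ

Assignment : ℕ → ℕ → Set
Assignment ni nx = Var ni nx → Bool

evalLabel : ∀ {ni nx} → Assignment ni nx → Label ni nx → Bool
evalLabel σ (lit ℓ) = if pol ℓ then σ (var ℓ) else not (σ (var ℓ))
evalLabel σ (cst b) = b

evalTree : ∀ {L : Set} → (L → Bool) → Tree L → Bool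
evalTree v (leaf l)  = v l
evalTree v (and t u) = evalTree v t ∧ evalTree v u
evalTree v (or t u)  = evalTree v t ∨ evalTree v u

eval : ∀ {ni nx L} → Circuit ni nx L → Assignment ni nx → Bool
eval G σ = evalTree (λ l → evalLabel σ (lab G l)) (tree G)

LeafSet : Set → Set
LeafSet L = L → Bool

relabel : ∀ {ni nx L} → LeafSet L → Bool → Circuit ni nx L → Circuit ni nx L
relabel S b G = mkCircuit (tree G) (λ l → if S l then cst b else lab G l)

-- Evaluation of G|_{ℓ=w, ¬ℓ=w'} under σ (the fresh variables w, w' given
-- as Boolean values). All v_ℓ-leaves are replaced, so σ(v_ℓ) is irrelevant.
evalWW : ∀ {ni nx L} → Lit ni nx → Circuit ni nx L → Assignment ni nx
       → Bool → Bool → Bool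
evalWW ℓ G σ w w' = evalTree val (tree G)
  where
  valL : Label _ _ → Bool
  valL (lit ℓ') = if does (var ℓ' ≟v var ℓ)
                  then (if does (pol ℓ' ≟ᵇ pol ℓ) then w else w')
                  else evalLabel σ (lit ℓ')
  valL (cst b) = b
  val = λ l → valL (lab G l)

AndRealizable : ∀ {ni nx L} → Lit ni nx → Circuit ni nx L → Set
AndRealizable ℓ G =
  Σ (Assignment _ _) λ σ → ∀ w w' → evalWW ℓ G σ w w' ≡ (w ∧ w')

ConsistentWith : ∀ {ni nx L} → Circuit ni nx L → LeafSet L → Lit ni nx → Set
ConsistentWith G S ℓ = ∀ l → S l ≡ true → lab G l ≡ lit ℓ

SetAndUnrealizable : ∀ {ni nx L} → Circuit ni nx L → LeafSet L → Set
SetAndUnrealizable {ni} {nx} G S =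
  (ℓ : Lit ni nx) → ConsistentWith G S ℓ →
  ¬ AndRealizable ℓ (relabel (λ l → isLit ℓ (lab G l) ∧ not (S l)) false G)

IndependentOfX : ∀ {ni nx L} → Circuit ni nx L → Set
IndependentOfX G = ∀ σ σ' → (∀ i → σ (inj₁ i) ≡ σ' (inj₁ i)) → eval G σ ≡ eval G σ'

AreLeafSets : ∀ {ni nx L} → Circuit ni nx L → List (LeafSet L) → Set
AreLeafSets G SS = All (λ S → ∀ l → S l ≡ true → Occurs l (tree G)) SS

PairwiseDisjoint : ∀ {L} → List (LeafSet L) → Set
PairwiseDisjoint [] = Data.Unit.⊤ where import Data.Unit
PairwiseDisjoint (S ∷ SS) =
  All (λ T → ∀ l → S l ≡ true → T l ≡ true → Data.Empty.⊥) SS × PairwiseDisjoint SS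
  where import Data.Empty

Chain : ∀ {ni nx L} → Circuit ni nx L → List (LeafSet L) → Set
Chain G []       = IndependentOfX G
Chain G (S ∷ SS) = SetAndUnrealizable G S × Chain (relabel S true G) SS

SAUNF : ∀ {ni nx L} → Circuit ni nx L → List (LeafSet L) → Set
SAUNF G SS =
  (SS ≢ []) ×
  AreLeafSets G SS ×
  PairwiseDisjoint SS ×
  All (λ S → Σ _ λ ℓ → IsXLit ℓ × ConsistentWith G S ℓ) SS ×
  Chain G SS

liftˡ : ∀ {L M} → LeafSet L → LeafSet (L ⊎ M)
liftˡ S = [ S , (λ _ → false) ]ˡ

liftʳ : ∀ {L M} → LeafSet M → LeafSet (L ⊎ M)
liftʳ S = [ (λ _ → false) , S ]ˡ

-- Unrealizability of a leaf set of G survives in G ∨ H: after the ℓ-leaves of H are set to ⊥,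
-- the H-disjunct no longer depends on the value w of ℓ, and a disjunct b(w') with
-- a(w,w') ∨ b(w') = w ∧ w' must vanish (take (w,w') = (⊥,⊤) and (⊤,⊥)), so a realizer of
-- ℓ in G ∨ H already realizes ℓ in G. Relabelling by the lifted sets of one side acts on
-- G ∨ H exactly as on that side, so the chains of G and H concatenate, and the final
-- circuit is a disjunction of two X-independent ones.
module Submission where

open import Defs
open import Data.Bool using (Bool; true; false; _∧_; _∨_; not; if_then_else_)
open import Data.Bool.Properties using (∨-identityʳ; ∨-comm; ∨-conicalʳ; ∧-identityʳ)
  renaming (_≟_ to _≟ᵇ_)
open import Data.Empty using (⊥)
open import Data.List using (List; []; _∷_; map; _++_)
open import Data.List.Relation.Unary.All as All using (All; []; _∷_)
open import Data.List.Relation.Unary.All.Properties using (map⁺; ++⁺)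
open import Data.List.Relation.Unary.AllPairs as AllPairs using (AllPairs; []; _∷_)
import Data.List.Relation.Unary.AllPairs.Properties as AllPairs
open import Data.Nat using (ℕ)
open import Data.Product using (Σ; _×_; _,_; proj₂)
open import Data.Sum using (_⊎_; inj₁; inj₂)
open import Data.Unit using (tt)
open import Function using (_∘_)
open import Relation.Nullary using (does; yes; no)
open import Relation.Binary.PropositionalEquality using (_≡_; _≢_; refl; sym; trans; cong; cong₂)
open Relation.Binary.PropositionalEquality.≡-Reasoning

private
  variable
    ni nx : ℕ
    A B L M : Set

evalTree-cong : {f g : L → Bool} (t : Tree L) → (∀ l → f l ≡ g l) → evalTree f t ≡ evalTree g t
evalTree-cong (leaf l)  f≗g = f≗g l
evalTree-cong (and t u) f≗g = cong₂ _∧_ (evalTree-cong t f≗g) (evalTree-cong u f≗g)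
evalTree-cong (or t u)  f≗g = cong₂ _∨_ (evalTree-cong t f≗g) (evalTree-cong u f≗g)

evalTree-mapTree : (f : A → B) (v : B → Bool) (t : Tree A) →
                   evalTree v (mapTree f t) ≡ evalTree (v ∘ f) t
evalTree-mapTree f v (leaf a)  = refl
evalTree-mapTree f v (and t u) = cong₂ _∧_ (evalTree-mapTree f v t) (evalTree-mapTree f v u)
evalTree-mapTree f v (or t u)  = cong₂ _∨_ (evalTree-mapTree f v t) (evalTree-mapTree f v u)

Occurs-mapTree : (f : A → B) {a : A} {t : Tree A} → Occurs a t → Occurs (f a) (mapTree f t)
Occurs-mapTree f here     = here
Occurs-mapTree f (andˡ o) = andˡ (Occurs-mapTree f o)
Occurs-mapTree f (andʳ o) = andʳ (Occurs-mapTree f o)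
Occurs-mapTree f (orˡ o)  = orˡ (Occurs-mapTree f o)
Occurs-mapTree f (orʳ o)  = orʳ (Occurs-mapTree f o)

evalLabelWW : Lit ni nx → Assignment ni nx → Bool → Bool → Label ni nx → Bool
evalLabelWW ℓ σ w w' (lit ℓ') = if does (var ℓ' ≟v var ℓ)
                                then (if does (pol ℓ' ≟ᵇ pol ℓ) then w else w')
                                else evalLabel σ (lit ℓ')
evalLabelWW ℓ σ w w' (cst b)  = b

-- The leaf valuation of evalWW is local to a where-block of Defs; leafValues recovers it
-- by unification, so that it can be unfolded label by label.
leafValues : {v : L → Bool} {t : Tree L} {b : Bool} → evalTree v t ≡ b → L → Bool
leafValues {v = v} _ = v

evalWW-unfold : (ℓ : Lit ni nx) (C : Circuit ni nx L) (σ : Assignment ni nx) (w w' : Bool) →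
                evalWW ℓ C σ w w' ≡ evalTree (evalLabelWW ℓ σ w w' ∘ lab C) (tree C)
evalWW-unfold ℓ C σ w w' = evalTree-cong (tree C) agree
  where
  agree : ∀ l → leafValues {t = tree C} (refl {x = evalWW ℓ C σ w w'}) l
                ≡ evalLabelWW ℓ σ w w' (lab C l)
  agree l with lab C l
  ... | lit _ = refl
  ... | cst _ = refl

evalLabelWW-¬isLit : (ℓ : Lit ni nx) (σ : Assignment ni nx) {w₁ w₂ w' : Bool} (x : Label ni nx) →
                     isLit ℓ x ≡ false → evalLabelWW ℓ σ w₁ w' x ≡ evalLabelWW ℓ σ w₂ w' x
evalLabelWW-¬isLit ℓ σ (cst b)  _ = refl
evalLabelWW-¬isLit ℓ σ (lit ℓ') _ with var ℓ' ≟v var ℓ | pol ℓ' ≟ᵇ pol ℓ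
evalLabelWW-¬isLit ℓ σ (lit ℓ') () | yes _ | yes _
... | yes _ | no _ = refl
... | no _  | _    = refl

Realizes : Lit ni nx → Circuit ni nx L → Assignment ni nx → Set
Realizes ℓ C σ = ∀ w w' → evalWW ℓ C σ w w' ≡ w ∧ w'

IgnoresLitValue : Lit ni nx → Circuit ni nx L → Assignment ni nx → Set
IgnoresLitValue ℓ C σ = ∀ w₁ w₂ w' → evalWW ℓ C σ w₁ w' ≡ evalWW ℓ C σ w₂ w'

ignoresLitValue-relabel : (ℓ : Lit ni nx) (σ : Assignment ni nx) (C : Circuit ni nx L) {R : LeafSet L} →
                          (∀ l → isLit ℓ (lab C l) ≡ true → R l ≡ true) →
                          IgnoresLitValue ℓ (relabel R false C) σ
ignoresLitValue-relabel {ni} {nx} {L} ℓ σ C {R} R⊇ℓ w₁ w₂ w' = begin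
  evalWW ℓ C' σ w₁ w'                             ≡⟨ evalWW-unfold ℓ C' σ w₁ w' ⟩
  evalTree (evalLabelWW ℓ σ w₁ w' ∘ lab C') (tree C) ≡⟨ evalTree-cong (tree C) agree ⟩
  evalTree (evalLabelWW ℓ σ w₂ w' ∘ lab C') (tree C) ≡⟨ evalWW-unfold ℓ C' σ w₂ w' ⟨
  evalWW ℓ C' σ w₂ w'                             ∎
  where
  C' : Circuit ni nx L
  C' = relabel R false C

  agree : ∀ l → evalLabelWW ℓ σ w₁ w' (lab C' l) ≡ evalLabelWW ℓ σ w₂ w' (lab C' l)
  agree l with R l in Rl
  ... | true  = refl
  ... | false with isLit ℓ (lab C l) in isℓ
  ...   | false = evalLabelWW-¬isLit ℓ σ (lab C l) isℓ
  ...   | true  with () ← trans (sym (R⊇ℓ l isℓ)) Rl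

∨-independent⇒∧ : (a b : Bool → Bool → Bool) → (∀ w₁ w₂ w' → b w₁ w' ≡ b w₂ w') →
                  (∀ w w' → a w w' ∨ b w w' ≡ w ∧ w') → ∀ w w' → a w w' ≡ w ∧ w'
∨-independent⇒∧ a b b-indep a∨b w w' = begin
  a w w'          ≡⟨ ∨-identityʳ (a w w') ⟨
  a w w' ∨ false  ≡⟨ cong (a w w' ∨_) (b≡false w') ⟨
  a w w' ∨ b w w' ≡⟨ a∨b w w' ⟩
  w ∧ w'          ∎
  where
  b≡false : ∀ w' → b w w' ≡ false
  b≡false true  = trans (b-indep w false true) (∨-conicalʳ _ _ (a∨b false true))
  b≡false false = trans (b-indep w true false) (∨-conicalʳ _ _ (a∨b true false))

_≗ᶜ_ : Circuit ni nx L → Circuit ni nx L → Set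
C ≗ᶜ D = tree C ≡ tree D × (∀ l → lab C l ≡ lab D l)

relabel-cong : {C D : Circuit ni nx L} {R R' : LeafSet L} (b : Bool) →
               C ≗ᶜ D → (∀ l → R l ≡ R' l) → relabel R b C ≗ᶜ relabel R' b D
relabel-cong b (t≡ , lab≗) R≗R' =
  t≡ , λ l → cong₂ (λ r x → if r then cst b else x) (R≗R' l) (lab≗ l)

eval-cong : {C D : Circuit ni nx L} → C ≗ᶜ D → ∀ σ → eval C σ ≡ eval D σ
eval-cong {C = mkCircuit t _} (refl , lab≗) σ = evalTree-cong t (cong (evalLabel σ) ∘ lab≗)

evalWW-cong : {C D : Circuit ni nx L} → C ≗ᶜ D → ∀ ℓ σ w w' → evalWW ℓ C σ w w' ≡ evalWW ℓ D σ w w'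
evalWW-cong {C = C@(mkCircuit t _)} {D} (refl , lab≗) ℓ σ w w' = begin
  evalWW ℓ C σ w w'                         ≡⟨ evalWW-unfold ℓ C σ w w' ⟩
  evalTree (evalLabelWW ℓ σ w w' ∘ lab C) t ≡⟨ evalTree-cong t (cong (evalLabelWW ℓ σ w w') ∘ lab≗) ⟩
  evalTree (evalLabelWW ℓ σ w w' ∘ lab D) t ≡⟨ evalWW-unfold ℓ D σ w w' ⟨
  evalWW ℓ D σ w w'                         ∎

independentOfX-cong : {C D : Circuit ni nx L} → C ≗ᶜ D → IndependentOfX C → IndependentOfX D
independentOfX-cong C≗D indep σ σ' same-I =
  trans (sym (eval-cong C≗D σ)) (trans (indep σ σ' same-I) (eval-cong C≗D σ'))

unrealizable-cong : {C D : Circuit ni nx L} → C ≗ᶜ D → ∀ S → SetAndUnrealizable C S → SetAndUnrealizable D S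
unrealizable-cong {C = C} {D} C≗D S unrealizable ℓ consistent (σ , realizes) =
  unrealizable ℓ (λ l Sl → trans (proj₂ C≗D l) (consistent l Sl))
    (σ , λ w w' → trans (evalWW-cong relabelled≗ ℓ σ w w') (realizes w w'))
  where
  relabelled≗ : relabel (λ l → isLit ℓ (lab C l) ∧ not (S l)) false C
             ≗ᶜ relabel (λ l → isLit ℓ (lab D l) ∧ not (S l)) false D
  relabelled≗ = relabel-cong false C≗D (λ l → cong (λ x → isLit ℓ x ∧ not (S l)) (proj₂ C≗D l))

chain-cong : {C D : Circuit ni nx L} → C ≗ᶜ D → ∀ SS → Chain C SS → Chain D SS
chain-cong C≗D []       indep                   = independentOfX-cong C≗D indep
chain-cong C≗D (S ∷ SS) (unrealizable , chain) =
  unrealizable-cong C≗D S unrealizable , chain-cong (relabel-cong true C≗D (λ _ → refl)) SS chain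

evalTree-or-mapTree : (v : L ⊎ M → Bool) (t : Tree L) (u : Tree M) →
                      evalTree v (or (mapTree inj₁ t) (mapTree inj₂ u)) ≡ evalTree (v ∘ inj₁) t ∨ evalTree (v ∘ inj₂) u
evalTree-or-mapTree v t u = cong₂ _∨_ (evalTree-mapTree inj₁ v t) (evalTree-mapTree inj₂ v u)

eval-∨ᶜ : (G : Circuit ni nx L) (H : Circuit ni nx M) → ∀ σ → eval (G ∨ᶜ H) σ ≡ eval G σ ∨ eval H σ
eval-∨ᶜ G H σ = evalTree-or-mapTree _ (tree G) (tree H)

evalWW-∨ᶜ : (G : Circuit ni nx L) (H : Circuit ni nx M) →
            ∀ ℓ σ w w' → evalWW ℓ (G ∨ᶜ H) σ w w' ≡ evalWW ℓ G σ w w' ∨ evalWW ℓ H σ w w'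
evalWW-∨ᶜ G H ℓ σ w w' = begin
  evalWW ℓ (G ∨ᶜ H) σ w w'
    ≡⟨ evalWW-unfold ℓ (G ∨ᶜ H) σ w w' ⟩
  evalTree (evalLabelWW ℓ σ w w' ∘ lab (G ∨ᶜ H)) (tree (G ∨ᶜ H))
    ≡⟨ evalTree-or-mapTree _ (tree G) (tree H) ⟩
  evalTree (evalLabelWW ℓ σ w w' ∘ lab G) (tree G) ∨ evalTree (evalLabelWW ℓ σ w w' ∘ lab H) (tree H)
    ≡⟨ cong₂ _∨_ (evalWW-unfold ℓ G σ w w') (evalWW-unfold ℓ H σ w w') ⟨
  evalWW ℓ G σ w w' ∨ evalWW ℓ H σ w w'
    ∎

relabel-∨ᶜ : (G : Circuit ni nx L) (H : Circuit ni nx M) (R : LeafSet (L ⊎ M)) (b : Bool) →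
             relabel R b (G ∨ᶜ H) ≗ᶜ (relabel (R ∘ inj₁) b G ∨ᶜ relabel (R ∘ inj₂) b H)
relabel-∨ᶜ G H R b = refl , λ { (inj₁ _) → refl ; (inj₂ _) → refl }

module _ {ℓ : Lit ni nx} {σ : Assignment ni nx} (G : Circuit ni nx L) (H : Circuit ni nx M) where

  realizes-∨ᶜ⁻ˡ : IgnoresLitValue ℓ H σ → Realizes ℓ (G ∨ᶜ H) σ → Realizes ℓ G σ
  realizes-∨ᶜ⁻ˡ H-ignores realizes = ∨-independent⇒∧ (λ w w' → evalWW ℓ G σ w w') (λ w w' → evalWW ℓ H σ w w')
    H-ignores (λ w w' → trans (sym (evalWW-∨ᶜ G H ℓ σ w w')) (realizes w w'))

  realizes-∨ᶜ⁻ʳ : IgnoresLitValue ℓ G σ → Realizes ℓ (G ∨ᶜ H) σ → Realizes ℓ H σ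
  realizes-∨ᶜ⁻ʳ G-ignores realizes = ∨-independent⇒∧ (λ w w' → evalWW ℓ H σ w w') (λ w w' → evalWW ℓ G σ w w')
    G-ignores (λ w w' → trans (∨-comm (evalWW ℓ H σ w w') (evalWW ℓ G σ w w'))
                              (trans (sym (evalWW-∨ᶜ G H ℓ σ w w')) (realizes w w')))

module _ (G : Circuit ni nx L) (H : Circuit ni nx M) where

  relabel-liftˡ : (S : LeafSet L) (b : Bool) → (relabel S b G ∨ᶜ H) ≗ᶜ relabel (liftˡ S) b (G ∨ᶜ H)
  relabel-liftˡ S b = refl , λ { (inj₁ _) → refl ; (inj₂ _) → refl }

  relabel-liftʳ : (S : LeafSet M) (b : Bool) → (G ∨ᶜ relabel S b H) ≗ᶜ relabel (liftʳ S) b (G ∨ᶜ H)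
  relabel-liftʳ S b = refl , λ { (inj₁ _) → refl ; (inj₂ _) → refl }

  unrealizable-∨ᶜˡ : ∀ S → SetAndUnrealizable G S → SetAndUnrealizable (G ∨ᶜ H) (liftˡ S)
  unrealizable-∨ᶜˡ S unrealizable ℓ consistent (σ , realizes) =
    unrealizable ℓ (consistent ∘ inj₁)
      (σ , realizes-∨ᶜ⁻ˡ (relabel (R ∘ inj₁) false G) (relabel (R ∘ inj₂) false H)
      (ignoresLitValue-relabel ℓ σ H (λ _ isℓ → trans (∧-identityʳ _) isℓ))
      (λ w w' → trans (sym (evalWW-cong (relabel-∨ᶜ G H R false) ℓ σ w w')) (realizes w w')))
    where
    R : LeafSet (L ⊎ M)
    R k = isLit ℓ (lab (G ∨ᶜ H) k) ∧ not (liftˡ S k)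

  unrealizable-∨ᶜʳ : ∀ S → SetAndUnrealizable H S → SetAndUnrealizable (G ∨ᶜ H) (liftʳ S)
  unrealizable-∨ᶜʳ S unrealizable ℓ consistent (σ , realizes) =
    unrealizable ℓ (consistent ∘ inj₂)
      (σ , realizes-∨ᶜ⁻ʳ (relabel (R ∘ inj₁) false G) (relabel (R ∘ inj₂) false H)
      (ignoresLitValue-relabel ℓ σ G (λ _ isℓ → trans (∧-identityʳ _) isℓ))
      (λ w w' → trans (sym (evalWW-cong (relabel-∨ᶜ G H R false) ℓ σ w w')) (realizes w w')))
    where
    R : LeafSet (L ⊎ M)
    R k = isLit ℓ (lab (G ∨ᶜ H) k) ∧ not (liftʳ S k)

independentOfX-∨ᶜ : (G : Circuit ni nx L) (H : Circuit ni nx M) →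
                    IndependentOfX G → IndependentOfX H → IndependentOfX (G ∨ᶜ H)
independentOfX-∨ᶜ G H G-indep H-indep σ σ' same-I = begin
  eval (G ∨ᶜ H) σ        ≡⟨ eval-∨ᶜ G H σ ⟩
  eval G σ ∨ eval H σ    ≡⟨ cong₂ _∨_ (G-indep σ σ' same-I) (H-indep σ σ' same-I) ⟩
  eval G σ' ∨ eval H σ'  ≡⟨ eval-∨ᶜ G H σ' ⟨
  eval (G ∨ᶜ H) σ'       ∎

chain-∨ᶜʳ : (G : Circuit ni nx L) (H : Circuit ni nx M) → IndependentOfX G →
            ∀ SH → Chain H SH → Chain (G ∨ᶜ H) (map liftʳ SH)
chain-∨ᶜʳ G H G-indep []       H-indep                 = independentOfX-∨ᶜ G H G-indep H-indep
chain-∨ᶜʳ G H G-indep (S ∷ SH) (unrealizable , chain) =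
  unrealizable-∨ᶜʳ G H S unrealizable ,
  chain-cong (relabel-liftʳ G H S true) (map liftʳ SH) (chain-∨ᶜʳ G (relabel S true H) G-indep SH chain)

chain-∨ᶜ : (G : Circuit ni nx L) (H : Circuit ni nx M) →
           ∀ SG SH → Chain G SG → Chain H SH → Chain (G ∨ᶜ H) (map liftˡ SG ++ map liftʳ SH)
chain-∨ᶜ G H []       SH G-indep                 H-chain = chain-∨ᶜʳ G H G-indep SH H-chain
chain-∨ᶜ G H (S ∷ SG) SH (unrealizable , G-chain) H-chain =
  unrealizable-∨ᶜˡ G H S unrealizable ,
  chain-cong (relabel-liftˡ G H S true) (map liftˡ SG ++ map liftʳ SH)
    (chain-∨ᶜ (relabel S true G) H SG SH G-chain H-chain)

Disjoint : LeafSet L → LeafSet L → Set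
Disjoint S T = ∀ l → S l ≡ true → T l ≡ true → ⊥

pairwiseDisjoint⇒allPairs : ∀ (SS : List (LeafSet L)) → PairwiseDisjoint SS → AllPairs Disjoint SS
pairwiseDisjoint⇒allPairs []       _             = []
pairwiseDisjoint⇒allPairs (S ∷ SS) (disj , rest) = disj ∷ pairwiseDisjoint⇒allPairs SS rest

allPairs⇒pairwiseDisjoint : {SS : List (LeafSet L)} → AllPairs Disjoint SS → PairwiseDisjoint SS
allPairs⇒pairwiseDisjoint []            = tt
allPairs⇒pairwiseDisjoint (disj ∷ rest) = disj , allPairs⇒pairwiseDisjoint rest

pairwiseDisjoint-lift : (SG : List (LeafSet L)) (SH : List (LeafSet M)) →
                        PairwiseDisjoint SG → PairwiseDisjoint SH →
                        PairwiseDisjoint (map liftˡ SG ++ map liftʳ SH)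
pairwiseDisjoint-lift SG SH SG-disj SH-disj = allPairs⇒pairwiseDisjoint (AllPairs.++⁺
  (AllPairs.map⁺ (AllPairs.map liftˡ-disjoint (pairwiseDisjoint⇒allPairs SG SG-disj)))
  (AllPairs.map⁺ (AllPairs.map liftʳ-disjoint (pairwiseDisjoint⇒allPairs SH SH-disj)))
  (map⁺ (All.universal (λ _ → map⁺ (All.universal (λ _ → liftˡ-liftʳ-disjoint) SH)) SG)))
  where
  liftˡ-disjoint : {S T : LeafSet L} → Disjoint S T → Disjoint (liftˡ {M = M} S) (liftˡ T)
  liftˡ-disjoint disj = λ { (inj₁ l) → disj l }
  liftʳ-disjoint : {S T : LeafSet M} → Disjoint S T → Disjoint (liftʳ {L = L} S) (liftʳ T)
  liftʳ-disjoint disj = λ { (inj₂ m) → disj m }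
  liftˡ-liftʳ-disjoint : {S : LeafSet L} {T : LeafSet M} → Disjoint (liftˡ S) (liftʳ T)
  liftˡ-liftʳ-disjoint = λ { (inj₁ _) _ () ; (inj₂ _) () }

XLiteralConsistent : Circuit ni nx L → LeafSet L → Set
XLiteralConsistent {ni} {nx} C S = Σ (Lit ni nx) λ ℓ → IsXLit ℓ × ConsistentWith C S ℓ

++-lift-nonempty : {SG : List (LeafSet L)} (SH : List (LeafSet M)) →
                   SG ≢ [] → map liftˡ SG ++ map liftʳ SH ≢ []
++-lift-nonempty {SG = []}    _ SG≢[] = λ _ → SG≢[] refl
++-lift-nonempty {SG = _ ∷ _} _ _     = λ ()

module _ (G : Circuit ni nx L) (H : Circuit ni nx M) where

  areLeafSets-∨ᶜ : (SG : List (LeafSet L)) (SH : List (LeafSet M)) →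
                   AreLeafSets G SG → AreLeafSets H SH → AreLeafSets (G ∨ᶜ H) (map liftˡ SG ++ map liftʳ SH)
  areLeafSets-∨ᶜ SG SH SG-leaves SH-leaves = ++⁺
    (map⁺ (All.map (λ leaves → λ { (inj₁ l) Sl → orˡ (Occurs-mapTree inj₁ (leaves l Sl)) }) SG-leaves))
    (map⁺ (All.map (λ leaves → λ { (inj₂ m) Sm → orʳ (Occurs-mapTree inj₂ (leaves m Sm)) }) SH-leaves))

  xLiteralConsistent-∨ᶜ : (SG : List (LeafSet L)) (SH : List (LeafSet M)) →
                          All (XLiteralConsistent G) SG → All (XLiteralConsistent H) SH →
                          All (XLiteralConsistent (G ∨ᶜ H)) (map liftˡ SG ++ map liftʳ SH)
  xLiteralConsistent-∨ᶜ SG SH SG-consistent SH-consistent = ++⁺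
    (map⁺ (All.map (λ { (ℓ , isX , consistent) → ℓ , isX , λ { (inj₁ l) → consistent l } }) SG-consistent))
    (map⁺ (All.map (λ { (ℓ , isX , consistent) → ℓ , isX , λ { (inj₂ m) → consistent m } }) SH-consistent))

lemma6 : ∀ {ni nx : ℕ} {L M : Set} (G : Circuit ni nx L) (H : Circuit ni nx M)
           (SG : List (LeafSet L)) (SH : List (LeafSet M)) →
           SAUNF G SG → SAUNF H SH →
           SAUNF (G ∨ᶜ H) (map liftˡ SG ++ map liftʳ SH)
lemma6 G H SG SH (SG≢[] , SG-leaves , SG-disj , SG-consistent , G-chain)
                 (_     , SH-leaves , SH-disj , SH-consistent , H-chain) =
  ++-lift-nonempty SH SG≢[] ,
  areLeafSets-∨ᶜ G H SG SH SG-leaves SH-leaves ,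
  pairwiseDisjoint-lift SG SH SG-disj SH-disj ,
  xLiteralConsistent-∨ᶜ G H SG SH SG-consistent SH-consistent ,
  chain-∨ᶜ G H SG SH G-chain H-chain
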